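{- For all $d \ge 2$, with $\tau = d\,(d-1)\ldots 2\,1$ the decreasing permutation of length $d$, $$P_{132,\tau}(x) = \frac{(1-x-x^2)\sum_{i=0}^{d-3}x^i(1+x)^i(1-x)^{d-i-2} + x^{d-2}(1+x)^{d-2}}{(1-x)^{d-1}}.$$
   Context: $S_n$ is the set of permutations of $\{1,\dots,n\}$ in one-line notation. A permutation avoids a pattern $\sigma\in S_k$ if it has no subsequence of length $k$ whose entries are in the same relative order as $\sigma$. $\mathcal{P}_n(132)$ is the set of permutations in $S_n$ avoiding each of $132$, $2341$, $3241$ (equivalently, the two-stack sortable permutations avoiding $132$), and $\mathcal{P}_0(132)$ contains only the empty permutation. For a pattern $\tau$, $\mathcal{P}_n(132,\tau)$ is the set of elements of $\mathcal{P}_n(132)$ that also avoid $\tau$, and $P_{132,\tau}(x)=\sum_{n\ge 0}|\mathcal{P}_n(132,\tau)|x^n$. An empty sum equals $0$. -}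

module Defs where

open import Data.Nat as ℕ using (ℕ; zero; suc; _∸_; _<ᵇ_)
open import Data.Integer as ℤ using (ℤ; +_; _+_; _*_; _-_)
open import Data.Bool using (Bool; true; false; _∧_; _∨_; not; if_then_else_)
open import Data.List using (List; []; _∷_; map; concatMap; length; filter; upTo; reverse; applyUpTo; _++_)
open import Data.Bool.ListAction using (all; any)
open import Data.Bool using (T)
open import Relation.Nullary.Decidable using (T?)

words : ℕ → ℕ → List (List ℕ)
words zero    k = [] ∷ []
words (suc n) k = concatMap (λ w → map (λ a → suc a ∷ w) (upTo k)) (words n k)

_==_ : ℕ → ℕ → Bool
m == n = ℕ._≡ᵇ_ m n

distinct : List ℕ → Bool
distinct []       = true
distinct (x ∷ xs) = all (λ y → not (x == y)) xs ∧ distinct xs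

Sn : ℕ → List (List ℕ)
Sn n = filter (λ w → T? (distinct w)) (words n n)

subseqs : List ℕ → List (List ℕ)
subseqs []       = [] ∷ []
subseqs (x ∷ xs) = let r = subseqs xs in map (x ∷_) r ++ r

_⇔ᵇ_ : Bool → Bool → Bool
true  ⇔ᵇ b = b
false ⇔ᵇ b = not b

relSame : ℕ → List ℕ → ℕ → List ℕ → Bool
relSame x []       a []       = true
relSame x (y ∷ ys) a (b ∷ bs) =
  ((x <ᵇ y) ⇔ᵇ (a <ᵇ b)) ∧ ((y <ᵇ x) ⇔ᵇ (b <ᵇ a)) ∧ relSame x ys a bs
relSame _ _ _ _ = false

orderIso : List ℕ → List ℕ → Bool
orderIso []       []       = true
orderIso (x ∷ xs) (a ∷ as) = relSame x xs a as ∧ orderIso xs as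
orderIso _ _ = false

contains : List ℕ → List ℕ → Bool
contains π σ = any (λ s → orderIso s σ) (subseqs π)

avoids : List ℕ → List ℕ → Bool
avoids π σ = not (contains π σ)

decr : ℕ → List ℕ
decr d = reverse (applyUpTo suc d)

-- |P_n(132, τ)| : permutations of length n avoiding 132, 2341, 3241 and τ
countP : List ℕ → ℕ → ℕ
countP τ n = length (filter (λ π → T? (avoids π (1 ∷ 3 ∷ 2 ∷ [])
                                      ∧ avoids π (2 ∷ 3 ∷ 4 ∷ 1 ∷ [])
                                      ∧ avoids π (3 ∷ 2 ∷ 4 ∷ 1 ∷ [])
                                      ∧ avoids π τ)) (Sn n))

Series : Set
Series = ℕ → ℤ

infixl 6 _⊕_ _⊖_
infixl 7 _⊗_
infixr 8 _^ˢ_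

_⊕_ : Series → Series → Series
(a ⊕ b) n = a n + b n

_⊖_ : Series → Series → Series
(a ⊖ b) n = a n - b n

sumℤ : List ℤ → ℤ
sumℤ []       = + 0
sumℤ (x ∷ xs) = x + sumℤ xs

_⊗_ : Series → Series → Series
(a ⊗ b) n = sumℤ (map (λ i → a i * b (n ∸ i)) (upTo (suc n)))

𝟘 : Series
𝟘 n = + 0

𝟙 : Series
𝟙 zero    = + 1
𝟙 (suc n) = + 0

X : Series
X (suc zero) = + 1
X _          = + 0

_^ˢ_ : Series → ℕ → Series
s ^ˢ zero  = 𝟙
s ^ˢ suc k = s ⊗ (s ^ˢ k)

Σˢ : ℕ → (ℕ → Series) → Series
Σˢ zero    f = 𝟘
Σˢ (suc m) f = Σˢ m f ⊕ f m

-- the series 1/(1-x) = Σ x^n  (the multiplicative inverse of 1 - x)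
geom : Series
geom n = + 1

Pdecr : ℕ → Series
Pdecr d n = + countP (decr d) n

numer : ℕ → Series
numer d =
  ((𝟙 ⊖ X) ⊖ (X ^ˢ 2)) ⊗ Σˢ (d ∸ 2) (λ i → (X ^ˢ i) ⊗ (((𝟙 ⊕ X) ^ˢ i) ⊗ ((𝟙 ⊖ X) ^ˢ (d ∸ i ∸ 2))))
  ⊕ ((X ^ˢ (d ∸ 2)) ⊗ ((𝟙 ⊕ X) ^ˢ (d ∸ 2)))

-- Let C_d be the generating function of P_n(132, d…1). In a permutation α n β ∈ P_n(132, (d+1)…1)
-- with n ≥ 3, 132-avoidance puts every entry of α above every entry of β, and avoiding 2341 and
-- 3241 leaves only three shapes: β empty, α empty, or α = n-1 with β nonempty. Removing n (and n-1)
-- gives c_{d+1}(n) = c_{d+1}(n-1) + c_d(n-1) + c_d(n-2), which together with the values for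
-- n ≤ 2 says (1-x) C_{d+1} = x(1+x) C_d + (1-x-x²), while C_1 = 1. The numerator N_d of the
-- theorem satisfies N_{d+1} = x(1+x) N_d + (1-x-x²)(1-x)^{d-1} and N_1 = 1, so by induction
-- N_d = (1-x)^{d-1} C_d, and C_d = N_d · geom^{d-1} as geom is the inverse of 1-x.

{-# OPTIONS --safe #-}
module Submission where

open import Defs
open import Data.Nat as ℕ using (ℕ; zero; suc; _<_; _≤_; _>_; _∸_; _<ᵇ_; z≤n; s≤s)
import Data.Nat.Properties as ℕ
open import Data.Integer as ℤ using (ℤ; +_; _+_; _*_; _-_; -_)
import Data.Integer.Properties as ℤ
open import Data.Integer.Tactic.RingSolver using (solve-∀)
open import Data.Bool using (Bool; true; false; T; not; _∧_)
open import Data.Bool.Properties using (T-∧; T-≡)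
open import Data.Empty using (⊥; ⊥-elim)
open import Data.Unit using (⊤; tt)
open import Data.Product using (∃-syntax; _×_; _,_; proj₁; proj₂)
open import Data.Sum using (_⊎_; inj₁; inj₂; [_,_]′)
open import Data.List
  using (List; []; _∷_; _++_; [_]; length; applyUpTo; applyDownFrom; map; upTo; filter)
open import Data.List.Properties
  using (map-upTo; reverse-applyUpTo; length-applyDownFrom; length-++-sucʳ; length-++; length-map;
         ∷ʳ-injective; ∷-injectiveˡ; ∷-injectiveʳ; ++-identityʳ; filter-all; filter-none)
open import Data.List.Relation.Unary.All as All using (All; []; _∷_)
import Data.List.Relation.Unary.All.Properties as All
open import Data.List.Relation.Unary.AllPairs using (AllPairs; []; _∷_)
import Data.List.Relation.Unary.AllPairs as AllPairs
import Data.List.Relation.Unary.AllPairs.Properties as AllPairs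
open import Data.List.Relation.Unary.Any using (here; there)
open import Data.List.Relation.Unary.Any.Properties using (any⁺; any⁻)
open import Data.List.Relation.Unary.Unique.Propositional using (Unique)
import Data.List.Relation.Unary.Unique.Propositional.Properties as Unique
open import Data.List.Membership.Propositional using (_∈_; _∉_; lose; find)
open import Data.List.Membership.Propositional.Properties
  using (∈-++⁻; ∈-++⁺ˡ; ∈-++⁺ʳ; ∈-map⁺; ∈-map⁻; ∈-∃++; ∈-concatMap⁺; ∈-concatMap⁻; ∈-upTo⁺; ∈-upTo⁻;
         ∈-filter⁺; ∈-filter⁻; ∈-insert)
open import Data.List.Membership.Propositional.Properties.WithK using (unique∧set⇒bag)
open import Data.List.Membership.DecPropositional ℕ._≟_ using (_∈?_)
open import Data.List.Relation.Binary.Sublist.Propositional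
  using (_⊆_; []; _∷_; _∷ʳ_; ⊆-refl; ⊆-trans; minimum; from∈)
open import Data.List.Relation.Binary.Sublist.Propositional.Properties
  using (All-resp-⊆; ++⁺; ++⁺ˡ; ++⁺ʳ; ∷ˡ⁻; ∷⁻; length-mono-≤)
open import Data.List.Relation.Binary.BagAndSetEquality using (∼bag⇒↭)
open import Data.List.Relation.Binary.Permutation.Propositional.Properties using (↭-length)
open import Function.Base using (_∘_)
open import Function.Bundles using (Equivalence; mk⇔)
open import Level using (0ℓ)
open import Algebra.Bundles using (CommutativeRing)
open import Algebra.Structures using (IsCommutativeRing)
import Algebra.Construct.Pointwise ℕ as Pointwise
import Algebra.Construct.Subst.Equality as SubstEquality
import Algebra.Properties.Ring as RingProperties
import Algebra.Solver.Ring.NaturalCoefficients.Default as NaturalCoefficientsSolver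
open import Relation.Nullary using (¬_; yes; no)
open import Relation.Nullary.Decidable using (T?)
open import Relation.Nullary.Reflects using (ofʸ)
open import Relation.Binary.Definitions using (Tri; tri<; tri≈; tri>)
import Relation.Binary.Reasoning.Setoid as SetoidReasoning
open import Relation.Binary.PropositionalEquality
  using (_≡_; _≢_; _≗_; refl; sym; trans; cong; cong₂; subst; module ≡-Reasoning)

-- Formal power series as a commutative ring

shift : Series → Series
shift a n = a (suc n)

-- A structurally recursive form of the Cauchy product, convenient for induction on the index.
cauchy : Series → Series → Series
cauchy a b zero    = a 0 * b 0
cauchy a b (suc n) = a 0 * b (suc n) + cauchy (shift a) b n

⊗≗cauchy : ∀ a b → a ⊗ b ≗ cauchy a b
⊗≗cauchy a b n = trans (cong sumℤ (map-upTo (λ i → a i * b (n ∸ i)) (suc n))) (go a n)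
  where
  go : ∀ a n → sumℤ (applyUpTo (λ i → a i * b (n ∸ i)) (suc n)) ≡ cauchy a b n
  go a zero    = ℤ.+-identityʳ _
  go a (suc n) = cong (_+_ (a 0 * b (suc n))) (go (shift a) n)

cauchy-cong : ∀ {a a′ b b′} → a ≗ a′ → b ≗ b′ → cauchy a b ≗ cauchy a′ b′
cauchy-cong p q zero    = cong₂ _*_ (p 0) (q 0)
cauchy-cong p q (suc n) = cong₂ _+_ (cong₂ _*_ (p 0) (q (suc n))) (cauchy-cong (λ k → p (suc k)) q n)

cauchy-zeroˡ : ∀ {a} b → a ≗ 𝟘 → cauchy a b ≗ 𝟘
cauchy-zeroˡ b p zero    rewrite p 0 = refl
cauchy-zeroˡ b p (suc n) rewrite p 0 | cauchy-zeroˡ b (λ k → p (suc k)) n = ℤ.*-zeroˡ (b (suc n))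

cauchy-identityˡ : ∀ b → cauchy 𝟙 b ≗ b
cauchy-identityˡ b zero    = ℤ.*-identityˡ (b 0)
cauchy-identityˡ b (suc n) rewrite cauchy-zeroˡ b (λ _ → refl) n =
  trans (ℤ.+-identityʳ _) (ℤ.*-identityˡ (b (suc n)))

cauchy-distribʳ : ∀ a a′ b → cauchy (a ⊕ a′) b ≗ cauchy a b ⊕ cauchy a′ b
cauchy-distribʳ a a′ b zero    = ℤ.*-distribʳ-+ (b 0) (a 0) (a′ 0)
cauchy-distribʳ a a′ b (suc n) rewrite cauchy-distribʳ (shift a) (shift a′) b n =
  regroup (a 0) (a′ 0) (b (suc n)) (cauchy (shift a) b n) (cauchy (shift a′) b n)
  where
  regroup : ∀ x y z u v → (x + y) * z + (u + v) ≡ (x * z + u) + (y * z + v)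
  regroup = solve-∀

cauchy-scaleˡ : ∀ x a b → cauchy (λ k → x * a k) b ≗ (λ k → x * cauchy a b k)
cauchy-scaleˡ x a b zero    = ℤ.*-assoc x (a 0) (b 0)
cauchy-scaleˡ x a b (suc n) rewrite cauchy-scaleˡ x (shift a) b n =
  factor x (a 0) (b (suc n)) (cauchy (shift a) b n)
  where
  factor : ∀ x y z u → x * y * z + x * u ≡ x * (y * z + u)
  factor = solve-∀

cauchy-sucʳ : ∀ a b n → cauchy a b (suc n) ≡ cauchy a (shift b) n + a (suc n) * b 0
cauchy-sucʳ a b zero    = refl
cauchy-sucʳ a b (suc n) rewrite cauchy-sucʳ (shift a) b n =
  sym (ℤ.+-assoc (a 0 * b (suc (suc n))) (cauchy (shift a) (shift b) n) _)

cauchy-comm : ∀ a b → cauchy a b ≗ cauchy b a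
cauchy-comm a b zero    = ℤ.*-comm (a 0) (b 0)
cauchy-comm a b (suc n) rewrite cauchy-sucʳ b a n | cauchy-comm (shift a) b n =
  trans (ℤ.+-comm (a 0 * b (suc n)) _) (cong (_+_ (cauchy b (shift a) n)) (ℤ.*-comm (a 0) (b (suc n))))

-- The first step uses that shift (cauchy a b) is definitionally
-- λ k → a 0 * b (suc k) + cauchy (shift a) b k.
cauchy-assoc : ∀ a b c → cauchy (cauchy a b) c ≗ cauchy a (cauchy b c)
cauchy-assoc a b c zero    = ℤ.*-assoc (a 0) (b 0) (c 0)
cauchy-assoc a b c (suc n) = begin
  a 0 * b 0 * c (suc n) + cauchy (shift (cauchy a b)) c n
    ≡⟨ cong (_+_ (a 0 * b 0 * c (suc n)))
         (cauchy-distribʳ (λ k → a 0 * b (suc k)) (cauchy (shift a) b) c n) ⟩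
  a 0 * b 0 * c (suc n) + (cauchy (λ k → a 0 * b (suc k)) c n + cauchy (cauchy (shift a) b) c n)
    ≡⟨ cong (_+_ (a 0 * b 0 * c (suc n)))
         (cong₂ _+_ (cauchy-scaleˡ (a 0) (shift b) c n) (cauchy-assoc (shift a) b c n)) ⟩
  a 0 * b 0 * c (suc n) + (a 0 * cauchy (shift b) c n + cauchy (shift a) (cauchy b c) n)
    ≡⟨ factor (a 0) (b 0) (c (suc n)) (cauchy (shift b) c n) (cauchy (shift a) (cauchy b c) n) ⟩
  a 0 * (b 0 * c (suc n) + cauchy (shift b) c n) + cauchy (shift a) (cauchy b c) n ∎
  where
  open ≡-Reasoning
  factor : ∀ x y z u v → x * y * z + (x * u + v) ≡ x * (y * z + u) + v
  factor = solve-∀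

infix 4 _≈_

-- A record rather than _≗_, so that a ≈ b does not unfold and a, b can be read off a proof.
record _≈_ (a b : Series) : Set where
  constructor coefficientwise
  field coeff : a ≗ b

open _≈_

neg : Series → Series
neg a n = - a n

⊗-cong : ∀ {a a′ b b′} → a ≈ a′ → b ≈ b′ → a ⊗ b ≈ a′ ⊗ b′
⊗-cong {a} {a′} {b} {b′} p q = coefficientwise λ n →
  trans (⊗≗cauchy a b n) (trans (cauchy-cong (coeff p) (coeff q) n) (sym (⊗≗cauchy a′ b′ n)))

⊗-comm : ∀ a b → a ⊗ b ≈ b ⊗ a
⊗-comm a b = coefficientwise λ n →
  trans (⊗≗cauchy a b n) (trans (cauchy-comm a b n) (sym (⊗≗cauchy b a n)))

⊗-assoc : ∀ a b c → (a ⊗ b) ⊗ c ≈ a ⊗ (b ⊗ c)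
⊗-assoc a b c = coefficientwise λ n → begin
  ((a ⊗ b) ⊗ c) n           ≡⟨ ⊗≗cauchy (a ⊗ b) c n ⟩
  cauchy (a ⊗ b) c n        ≡⟨ cauchy-cong (⊗≗cauchy a b) (λ _ → refl) n ⟩
  cauchy (cauchy a b) c n   ≡⟨ cauchy-assoc a b c n ⟩
  cauchy a (cauchy b c) n   ≡⟨ cauchy-cong (λ _ → refl) (λ k → sym (⊗≗cauchy b c k)) n ⟩
  cauchy a (b ⊗ c) n        ≡⟨ ⊗≗cauchy a (b ⊗ c) n ⟨
  (a ⊗ (b ⊗ c)) n           ∎
  where open ≡-Reasoning

⊗-identityˡ : ∀ a → 𝟙 ⊗ a ≈ a
⊗-identityˡ a = coefficientwise λ n → trans (⊗≗cauchy 𝟙 a n) (cauchy-identityˡ a n)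

⊗-distribʳ : ∀ a b c → (b ⊕ c) ⊗ a ≈ b ⊗ a ⊕ c ⊗ a
⊗-distribʳ a b c = coefficientwise λ n →
  trans (⊗≗cauchy (b ⊕ c) a n)
        (trans (cauchy-distribʳ b c a n) (sym (cong₂ _+_ (⊗≗cauchy b a n) (⊗≗cauchy c a n))))

⊕-⊗-isCommutativeRing : IsCommutativeRing _≈_ _⊕_ _⊗_ neg 𝟘 𝟙
⊕-⊗-isCommutativeRing = record
  { isRing = record
    { +-isAbelianGroup = SubstEquality.isAbelianGroup (coefficientwise , coeff)
                           (Pointwise.isAbelianGroup ℤ.+-0-isAbelianGroup)
    ; *-cong           = ⊗-cong
    ; *-assoc          = ⊗-assoc
    ; *-identity       = ⊗-identityˡ , λ a → ≈-trans (⊗-comm a 𝟙) (⊗-identityˡ a)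
    ; distrib          = (λ a b c → ≈-trans (⊗-comm a (b ⊕ c))
                                     (≈-trans (⊗-distribʳ a b c) (+-cong (⊗-comm b a) (⊗-comm c a))))
                         , ⊗-distribʳ
    }
  ; *-comm = ⊗-comm
  }
  where
  ≈-trans : ∀ {a b c} → a ≈ b → b ≈ c → a ≈ c
  ≈-trans p q = coefficientwise λ n → trans (coeff p n) (coeff q n)
  +-cong : ∀ {a a′ b b′} → a ≈ a′ → b ≈ b′ → a ⊕ b ≈ a′ ⊕ b′
  +-cong p q = coefficientwise λ n → cong₂ _+_ (coeff p n) (coeff q n)

⊕-⊗-commutativeRing : CommutativeRing 0ℓ 0ℓ
⊕-⊗-commutativeRing = record { isCommutativeRing = ⊕-⊗-isCommutativeRing }

open CommutativeRing ⊕-⊗-commutativeRing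
  using (setoid; +-cong; +-congˡ; +-congʳ; +-assoc; +-identityˡ; *-congˡ; *-congʳ; distribˡ; zeroʳ)
  renaming (refl to ≈-refl; sym to ≈-sym; trans to ≈-trans; *-identityʳ to ⊗-identityʳ)
open RingProperties (CommutativeRing.ring ⊕-⊗-commutativeRing) using (-‿distribˡ-*)
open NaturalCoefficientsSolver (CommutativeRing.commutativeSemiring ⊕-⊗-commutativeRing)
  using (solve; _:+_; _:*_; _:=_)
module ≈-Reasoning = SetoidReasoning setoid

-- The numerator

X⊗-suc : ∀ a n → (X ⊗ a) (suc n) ≡ a n
X⊗-suc a n = begin
  (X ⊗ a) (suc n)               ≡⟨ ⊗≗cauchy X a (suc n) ⟩
  + 0 + cauchy (shift X) a n    ≡⟨ ℤ.+-identityˡ _ ⟩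
  cauchy (shift X) a n          ≡⟨ cauchy-cong shiftX≗𝟙 (λ _ → refl) n ⟩
  cauchy 𝟙 a n                  ≡⟨ cauchy-identityˡ a n ⟩
  a n                           ∎
  where
  open ≡-Reasoning
  shiftX≗𝟙 : shift X ≗ 𝟙
  shiftX≗𝟙 zero    = refl
  shiftX≗𝟙 (suc n) = refl

U V Y Q : Series
U = 𝟙 ⊖ X
V = 𝟙 ⊕ X
Y = X ⊗ V
Q = (𝟙 ⊖ X) ⊖ X ^ˢ 2

U⊗ : ∀ a → U ⊗ a ≈ a ⊖ X ⊗ a
U⊗ a = begin
  (𝟙 ⊕ neg X) ⊗ a          ≈⟨ ⊗-distribʳ a 𝟙 (neg X) ⟩
  𝟙 ⊗ a ⊕ neg X ⊗ a        ≈⟨ +-cong (⊗-identityˡ a) (≈-sym (-‿distribˡ-* X a)) ⟩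
  a ⊕ neg (X ⊗ a)          ∎
  where open ≈-Reasoning

U⊗-zero : ∀ a → (U ⊗ a) 0 ≡ a 0
U⊗-zero a = trans (coeff (U⊗ a) 0) (ℤ.+-identityʳ (a 0))

U⊗-suc : ∀ a n → (U ⊗ a) (suc n) ≡ a (suc n) - a n
U⊗-suc a n = trans (coeff (U⊗ a) (suc n)) (cong (_-_ (a (suc n))) (X⊗-suc a n))

Y⊗ : ∀ b → Y ⊗ b ≈ X ⊗ (b ⊕ X ⊗ b)
Y⊗ b = begin
  (X ⊗ V) ⊗ b             ≈⟨ ⊗-assoc X V b ⟩
  X ⊗ (V ⊗ b)             ≈⟨ *-congˡ {X} (⊗-distribʳ b 𝟙 X) ⟩
  X ⊗ (𝟙 ⊗ b ⊕ X ⊗ b)     ≈⟨ *-congˡ {X} (+-congʳ {X ⊗ b} (⊗-identityˡ b)) ⟩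
  X ⊗ (b ⊕ X ⊗ b)         ∎
  where open ≈-Reasoning

Y⊗-zero : ∀ b → (Y ⊗ b) 0 ≡ + 0
Y⊗-zero b = coeff (Y⊗ b) 0

Y⊗-one : ∀ b → (Y ⊗ b) 1 ≡ b 0
Y⊗-one b = trans (coeff (Y⊗ b) 1) (trans (X⊗-suc (b ⊕ X ⊗ b) 0) (ℤ.+-identityʳ (b 0)))

Y⊗-suc-suc : ∀ b n → (Y ⊗ b) (suc (suc n)) ≡ b (suc n) + b n
Y⊗-suc-suc b n = trans (coeff (Y⊗ b) (suc (suc n)))
  (trans (X⊗-suc (b ⊕ X ⊗ b) (suc n)) (cong (_+_ (b (suc n))) (X⊗-suc b n)))

Q-suc³ : ∀ n → Q (suc (suc (suc n))) ≡ + 0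
Q-suc³ n rewrite X⊗-suc (X ⊗ 𝟙) (suc (suc n)) | X⊗-suc 𝟙 (suc n) = refl

Y⊕Q≈𝟙 : Y ⊕ Q ≈ 𝟙
Y⊕Q≈𝟙 = coefficientwise coefficients
  where
  positive : ∀ n → V n + Q (suc n) ≡ 𝟙 (suc n)
  positive zero          = refl
  positive (suc zero)    = refl
  positive (suc (suc n)) = cong (_+_ (V (suc (suc n)))) (Q-suc³ n)
  coefficients : Y ⊕ Q ≗ 𝟙
  coefficients zero    = refl
  coefficients (suc n) = trans (cong (_+ Q (suc n)) (X⊗-suc V n)) (positive n)

U⊗geom≈𝟙 : U ⊗ geom ≈ 𝟙
U⊗geom≈𝟙 = coefficientwise λ where
  zero    → U⊗-zero geom
  (suc n) → U⊗-suc geom n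

^ˢ-inverse : ∀ {a b} → a ⊗ b ≈ 𝟙 → ∀ k → a ^ˢ k ⊗ b ^ˢ k ≈ 𝟙
^ˢ-inverse ab≈𝟙 zero    = ⊗-identityˡ 𝟙
^ˢ-inverse {a} {b} ab≈𝟙 (suc k) = begin
  (a ⊗ a ^ˢ k) ⊗ (b ⊗ b ^ˢ k)   ≈⟨ interchange a (a ^ˢ k) b (b ^ˢ k) ⟩
  (a ⊗ b) ⊗ (a ^ˢ k ⊗ b ^ˢ k)   ≈⟨ ⊗-cong ab≈𝟙 (^ˢ-inverse ab≈𝟙 k) ⟩
  𝟙 ⊗ 𝟙                         ≈⟨ ⊗-identityˡ 𝟙 ⟩
  𝟙                             ∎
  where
  open ≈-Reasoning
  interchange : ∀ a a′ b b′ → (a ⊗ a′) ⊗ (b ⊗ b′) ≈ (a ⊗ b) ⊗ (a′ ⊗ b′)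
  interchange = solve 4 (λ a a′ b b′ → (a :* a′) :* (b :* b′) := (a :* b) :* (a′ :* b′)) ≈-refl

Σˢ-cong : ∀ m {f g : ℕ → Series} → (∀ i → f i ≈ g i) → Σˢ m f ≈ Σˢ m g
Σˢ-cong zero    f≈g = ≈-refl
Σˢ-cong (suc m) f≈g = +-cong (Σˢ-cong m f≈g) (f≈g m)

Σˢ-sucˡ : ∀ m f → Σˢ (suc m) f ≈ f 0 ⊕ Σˢ m (λ i → f (suc i))
Σˢ-sucˡ zero    f = coefficientwise λ n → ℤ.+-comm (+ 0) (f 0 n)
Σˢ-sucˡ (suc m) f = begin
  Σˢ (suc m) f ⊕ f (suc m)                         ≈⟨ +-congʳ {f (suc m)} (Σˢ-sucˡ m f) ⟩
  (f 0 ⊕ Σˢ m (λ i → f (suc i))) ⊕ f (suc m)        ≈⟨ +-assoc (f 0) _ (f (suc m)) ⟩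
  f 0 ⊕ Σˢ (suc m) (λ i → f (suc i))               ∎
  where open ≈-Reasoning

⊗-distribˡ-Σˢ : ∀ c m f → c ⊗ Σˢ m f ≈ Σˢ m (λ i → c ⊗ f i)
⊗-distribˡ-Σˢ c zero    f = zeroʳ c
⊗-distribˡ-Σˢ c (suc m) f = ≈-trans (distribˡ c (Σˢ m f) (f m)) (+-congʳ {c ⊗ f m} (⊗-distribˡ-Σˢ c m f))

numerTerm : ℕ → ℕ → Series
numerTerm k i = (X ^ˢ i) ⊗ ((V ^ˢ i) ⊗ (U ^ˢ (suc (suc k) ∸ i ∸ 2)))

numerSum : ℕ → Series
numerSum k = Σˢ k (numerTerm k)

numerSum-suc : ∀ k → numerSum (suc k) ≈ U ^ˢ suc k ⊕ Y ⊗ numerSum k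
numerSum-suc k = begin
  numerSum (suc k)
    ≈⟨ Σˢ-sucˡ k (numerTerm (suc k)) ⟩
  𝟙 ⊗ (𝟙 ⊗ U ^ˢ suc k) ⊕ Σˢ k (λ i → numerTerm (suc k) (suc i))
    ≈⟨ +-cong (≈-trans (⊗-identityˡ (𝟙 ⊗ U ^ˢ suc k)) (⊗-identityˡ (U ^ˢ suc k)))
              (Σˢ-cong k λ i → regroup X (X ^ˢ i) V (V ^ˢ i) (U ^ˢ (suc (suc k) ∸ i ∸ 2))) ⟩
  U ^ˢ suc k ⊕ Σˢ k (λ i → Y ⊗ numerTerm k i)
    ≈⟨ +-congˡ {U ^ˢ suc k} (⊗-distribˡ-Σˢ Y k (numerTerm k)) ⟨
  U ^ˢ suc k ⊕ Y ⊗ numerSum k ∎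
  where
  open ≈-Reasoning
  regroup : ∀ x x′ v v′ u → (x ⊗ x′) ⊗ ((v ⊗ v′) ⊗ u) ≈ (x ⊗ v) ⊗ (x′ ⊗ (v′ ⊗ u))
  regroup = solve 5 (λ x x′ v v′ u → (x :* x′) :* ((v :* v′) :* u) := (x :* v) :* (x′ :* (v′ :* u)))
                    ≈-refl

numer1≈𝟙 : numer 1 ≈ 𝟙
numer1≈𝟙 = ≈-trans (+-cong (zeroʳ Q) (⊗-identityˡ 𝟙)) (+-identityˡ 𝟙)

numer-suc : ∀ k → numer (suc (suc k)) ≈ Y ⊗ numer (suc k) ⊕ Q ⊗ U ^ˢ k
-- numer 2 and numer 1 coincide: both sums are empty.
numer-suc zero = begin
  numer 1               ≈⟨ numer1≈𝟙 ⟩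
  𝟙                     ≈⟨ Y⊕Q≈𝟙 ⟨
  Y ⊕ Q                 ≈⟨ +-cong (≈-trans (*-congˡ {Y} numer1≈𝟙) (⊗-identityʳ Y)) (⊗-identityʳ Q) ⟨
  Y ⊗ numer 1 ⊕ Q ⊗ 𝟙   ∎
  where open ≈-Reasoning
numer-suc (suc k) = begin
  Q ⊗ numerSum (suc k) ⊕ (X ⊗ X ^ˢ k) ⊗ (V ⊗ V ^ˢ k)
    ≈⟨ +-congʳ {(X ⊗ X ^ˢ k) ⊗ (V ⊗ V ^ˢ k)} (*-congˡ {Q} (numerSum-suc k)) ⟩
  Q ⊗ (U ^ˢ suc k ⊕ Y ⊗ numerSum k) ⊕ (X ⊗ X ^ˢ k) ⊗ (V ⊗ V ^ˢ k)
    ≈⟨ rearrange Q (U ^ˢ suc k) X V (numerSum k) (X ^ˢ k) (V ^ˢ k) ⟩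
  Y ⊗ (Q ⊗ numerSum k ⊕ (X ^ˢ k) ⊗ (V ^ˢ k)) ⊕ Q ⊗ U ^ˢ suc k ∎
  where
  open ≈-Reasoning
  rearrange : ∀ q u x v s x′ v′ →
    q ⊗ (u ⊕ (x ⊗ v) ⊗ s) ⊕ (x ⊗ x′) ⊗ (v ⊗ v′) ≈ (x ⊗ v) ⊗ (q ⊗ s ⊕ x′ ⊗ v′) ⊕ q ⊗ u
  rearrange = solve 7 (λ q u x v s x′ v′ →
    q :* (u :+ (x :* v) :* s) :+ (x :* x′) :* (v :* v′) := (x :* v) :* (q :* s :+ x′ :* v′) :+ q :* u)
    ≈-refl

-- At index n ≥ 3 the series identity is the recurrence; below that it involves the coefficients
-- 1, -1, -1 of Q, which the initial values account for.
recurrence⇒series : ∀ (f g : ℕ → ℕ) → f 0 ≡ 1 → f 1 ≡ 1 → g 0 ≡ 1 → f 2 ≡ suc (g 1) →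
  (∀ n → f (suc (suc (suc n))) ≡ f (suc (suc n)) ℕ.+ (g (suc (suc n)) ℕ.+ g (suc n))) →
  U ⊗ (λ n → + f n) ≈ Y ⊗ (λ n → + g n) ⊕ Q
recurrence⇒series f g f0 f1 g0 f2 fₙ = coefficientwise coefficients
  where
  F G : Series
  F n = + f n
  G n = + g n
  coefficients : U ⊗ F ≗ Y ⊗ G ⊕ Q
  coefficients zero = begin
    (U ⊗ F) 0             ≡⟨ U⊗-zero F ⟩
    + f 0                 ≡⟨ cong +_ f0 ⟩
    + 0 + Q 0             ≡⟨ cong (_+ Q 0) (Y⊗-zero G) ⟨
    (Y ⊗ G) 0 + Q 0       ∎
    where open ≡-Reasoning
  coefficients (suc zero) = begin
    (U ⊗ F) 1             ≡⟨ U⊗-suc F 0 ⟩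
    + f 1 - + f 0         ≡⟨ cong₂ (λ a b → + a - + b) f1 f0 ⟩
    + 1 - + 1             ≡⟨ cong (λ b → + b + Q 1) g0 ⟨
    + g 0 + Q 1           ≡⟨ cong (_+ Q 1) (Y⊗-one G) ⟨
    (Y ⊗ G) 1 + Q 1       ∎
    where open ≡-Reasoning
  coefficients (suc (suc zero)) = begin
    (U ⊗ F) 2                     ≡⟨ U⊗-suc F 1 ⟩
    + f 2 - + f 1                 ≡⟨ cong₂ (λ a b → + a - + b) f2 f1 ⟩
    + 1 + + g 1 - + 1             ≡⟨ commute (+ g 1) ⟩
    (+ g 1 + + 1) + Q 2           ≡⟨ cong (λ b → (+ g 1 + + b) + Q 2) g0 ⟨
    (+ g 1 + + g 0) + Q 2         ≡⟨ cong (_+ Q 2) (Y⊗-suc-suc G 0) ⟨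
    (Y ⊗ G) 2 + Q 2               ∎
    where
    open ≡-Reasoning
    commute : ∀ x → + 1 + x - + 1 ≡ (x + + 1) - + 1
    commute = solve-∀
  coefficients (suc (suc (suc n))) = begin
    (U ⊗ F) (3 ℕ.+ n)                           ≡⟨ U⊗-suc F (2 ℕ.+ n) ⟩
    + f (3 ℕ.+ n) - + f (2 ℕ.+ n)               ≡⟨ cong (λ a → + a - + f (2 ℕ.+ n)) (fₙ n) ⟩
    + f (2 ℕ.+ n) + (G (2 ℕ.+ n) + G (1 ℕ.+ n)) - + f (2 ℕ.+ n)
                                                ≡⟨ cancel (+ f (2 ℕ.+ n)) (G (2 ℕ.+ n) + G (1 ℕ.+ n)) ⟩
    (G (2 ℕ.+ n) + G (1 ℕ.+ n)) + + 0           ≡⟨ cong₂ _+_ (Y⊗-suc-suc G (suc n)) (Q-suc³ n) ⟨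
    (Y ⊗ G) (3 ℕ.+ n) + Q (3 ℕ.+ n)             ∎
    where
    open ≡-Reasoning
    cancel : ∀ x y → x + y - x ≡ y + + 0
    cancel = solve-∀

-- Order isomorphism and the forbidden patterns

<⇒<ᵇ≡true : ∀ {x y} → x < y → (x <ᵇ y) ≡ true
<⇒<ᵇ≡true x<y = Equivalence.to T-≡ (ℕ.<⇒<ᵇ x<y)

<⇒>ᵇ≡false : ∀ {x y} → x < y → (y <ᵇ x) ≡ false
<⇒>ᵇ≡false {x} {y} x<y with y <ᵇ x | ℕ.<ᵇ-reflects-< y x
... | false | _       = refl
... | true  | ofʸ y<x = ⊥-elim (ℕ.<-asym x<y y<x)

<ᵇ≡true⇒< : ∀ {x y} → (x <ᵇ y) ≡ true → x < y
<ᵇ≡true⇒< {x} {y} eq = ℕ.<ᵇ⇒< x y (Equivalence.from T-≡ eq)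

SameComparison : ℕ → ℕ → ℕ → ℕ → Set
SameComparison x y a b = (x <ᵇ y) ≡ (a <ᵇ b) × (y <ᵇ x) ≡ (b <ᵇ a)

ascending : ∀ {x y} → x < y → (x <ᵇ y) ≡ true × (y <ᵇ x) ≡ false
ascending x<y = <⇒<ᵇ≡true x<y , <⇒>ᵇ≡false x<y

descending : ∀ {x y} → y < x → (x <ᵇ y) ≡ false × (y <ᵇ x) ≡ true
descending y<x = <⇒>ᵇ≡false y<x , <⇒<ᵇ≡true y<x

-- For a
-- concrete σ the right-hand sides compute, leaving equations (x <ᵇ y) ≡ true or ≡ false, which
-- the patterns of the lemmas below pick out.
Agree : ℕ → List ℕ → ℕ → List ℕ → Set
Agree x []       a []       = ⊤
Agree x (y ∷ ys) a (b ∷ bs) = SameComparison x y a b × Agree x ys a bs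
Agree _ _        _ _        = ⊥

OrderIso : List ℕ → List ℕ → Set
OrderIso []       []       = ⊤
OrderIso (x ∷ xs) (a ∷ as) = Agree x xs a as × OrderIso xs as
OrderIso _        _        = ⊥

⇔ᵇ⇒≡ : ∀ p q → T (p ⇔ᵇ q) → p ≡ q
⇔ᵇ⇒≡ true  true  _ = refl
⇔ᵇ⇒≡ false false _ = refl

≡⇒⇔ᵇ : ∀ p q → p ≡ q → T (p ⇔ᵇ q)
≡⇒⇔ᵇ true  _ refl = tt
≡⇒⇔ᵇ false _ refl = tt

relSame⁻ : ∀ x ys a bs → T (relSame x ys a bs) → Agree x ys a bs
relSame⁻ x []       a []       _ = tt
relSame⁻ x (y ∷ ys) a (b ∷ bs) t =
  let t₁ , t₂₃ = Equivalence.to T-∧ t ; t₂ , t₃ = Equivalence.to T-∧ t₂₃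
  in (⇔ᵇ⇒≡ _ _ t₁ , ⇔ᵇ⇒≡ _ _ t₂) , relSame⁻ x ys a bs t₃

relSame⁺ : ∀ x ys a bs → Agree x ys a bs → T (relSame x ys a bs)
relSame⁺ x []       a []       _ = tt
relSame⁺ x (y ∷ ys) a (b ∷ bs) ((e₁ , e₂) , agree) =
  Equivalence.from T-∧ (≡⇒⇔ᵇ _ _ e₁ , Equivalence.from T-∧ (≡⇒⇔ᵇ _ _ e₂ , relSame⁺ x ys a bs agree))

orderIso⁻ : ∀ s σ → T (orderIso s σ) → OrderIso s σ
orderIso⁻ []       []       _ = tt
orderIso⁻ (x ∷ xs) (a ∷ as) t =
  let t₁ , t₂ = Equivalence.to T-∧ t in relSame⁻ x xs a as t₁ , orderIso⁻ xs as t₂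

orderIso⁺ : ∀ s σ → OrderIso s σ → T (orderIso s σ)
orderIso⁺ []       []       _ = tt
orderIso⁺ (x ∷ xs) (a ∷ as) (agree , iso) =
  Equivalence.from T-∧ (relSame⁺ x xs a as agree , orderIso⁺ xs as iso)

OrderIso-length : ∀ s σ → OrderIso s σ → length s ≡ length σ
OrderIso-length []       []       _          = refl
OrderIso-length (x ∷ xs) (a ∷ as) (_ , iso)  = cong suc (OrderIso-length xs as iso)

Contains : List ℕ → List ℕ → Set
Contains π σ = ∃[ s ] s ⊆ π × OrderIso s σ

Has132 : List ℕ → Set
Has132 π = ∃[ a ] ∃[ b ] ∃[ c ] (a ∷ b ∷ c ∷ []) ⊆ π × a < c × c < b

-- An occurrence of 2341 (if x < y) or of 3241 (if y < x).
Has2341or3241 : List ℕ → Set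
Has2341or3241 π = ∃[ x ] ∃[ y ] ∃[ z ] ∃[ w ]
  (x ∷ y ∷ z ∷ w ∷ []) ⊆ π × w < x × w < y × x < z × y < z × x ≢ y

HasDecreasing : ℕ → List ℕ → Set
HasDecreasing k π = ∃[ s ] s ⊆ π × length s ≡ k × AllPairs _>_ s

contains132⁻ : ∀ {π} → Contains π (1 ∷ 3 ∷ 2 ∷ []) → Has132 π
contains132⁻ (a ∷ b ∷ c ∷ [] , sub , ((_ , (a<c , _) , _) , ((_ , c<b) , _) , _)) =
  a , b , c , sub , <ᵇ≡true⇒< a<c , <ᵇ≡true⇒< c<b

contains132⁺ : ∀ {π} → Has132 π → Contains π (1 ∷ 3 ∷ 2 ∷ [])
contains132⁺ (a , b , c , sub , a<c , c<b) =
  a ∷ b ∷ c ∷ [] , sub ,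
  ((ascending (ℕ.<-trans a<c c<b) , ascending a<c , tt) , (descending c<b , tt) , tt , tt)

contains2341⁻ : ∀ {π} → Contains π (2 ∷ 3 ∷ 4 ∷ 1 ∷ []) → Has2341or3241 π
contains2341⁻ (x ∷ y ∷ z ∷ w ∷ [] , sub ,
               (((x<y , _) , _ , (_ , w<x) , _) , ((y<z , _) , _) , _)) =
  let w<x = <ᵇ≡true⇒< w<x ; x<y = <ᵇ≡true⇒< x<y ; y<z = <ᵇ≡true⇒< y<z
  in x , y , z , w , sub , w<x , ℕ.<-trans w<x x<y , ℕ.<-trans x<y y<z , y<z , ℕ.<⇒≢ x<y

contains3241⁻ : ∀ {π} → Contains π (3 ∷ 2 ∷ 4 ∷ 1 ∷ []) → Has2341or3241 π
contains3241⁻ (x ∷ y ∷ z ∷ w ∷ [] , sub ,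
               (((_ , y<x) , (x<z , _) , _) , (_ , (_ , w<y) , _) , _)) =
  let y<x = <ᵇ≡true⇒< y<x ; x<z = <ᵇ≡true⇒< x<z ; w<y = <ᵇ≡true⇒< w<y
  in x , y , z , w , sub , ℕ.<-trans w<y y<x , w<y , x<z , ℕ.<-trans y<x x<z , ℕ.>⇒≢ y<x

contains2341or3241⁺ : ∀ {π} → Has2341or3241 π →
  Contains π (2 ∷ 3 ∷ 4 ∷ 1 ∷ []) ⊎ Contains π (3 ∷ 2 ∷ 4 ∷ 1 ∷ [])
contains2341or3241⁺ {π} (x , y , z , w , sub , w<x , w<y , x<z , y<z , x≢y) = byOrder (ℕ.<-cmp x y)
  where
  rest : Agree y (z ∷ w ∷ []) 3 (4 ∷ 1 ∷ []) × OrderIso (z ∷ w ∷ []) (4 ∷ 1 ∷ [])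
  rest = (ascending y<z , descending w<y , tt) , (descending (ℕ.<-trans w<y y<z) , tt) , tt , tt
  byOrder : Tri (x < y) (x ≡ y) (y < x) →
    Contains π (2 ∷ 3 ∷ 4 ∷ 1 ∷ []) ⊎ Contains π (3 ∷ 2 ∷ 4 ∷ 1 ∷ [])
  byOrder (tri< x<y _ _) = inj₁ (_ , sub , (ascending x<y , ascending x<z , descending w<x , tt) , rest)
  byOrder (tri≈ _ x≡y _) = ⊥-elim (x≢y x≡y)
  byOrder (tri> _ _ y<x) = inj₂ (_ , sub , (descending y<x , ascending x<z , descending w<x , tt) , rest)

Agree-below⁻ : ∀ x ys a bs → All (_< a) bs → Agree x ys a bs → All (_< x) ys
Agree-below⁻ x []       a []       []           _                   = []
Agree-below⁻ x (y ∷ ys) a (b ∷ bs) (b<a ∷ bs<a) ((_ , y<ᵇx) , agree) =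
  <ᵇ≡true⇒< (trans y<ᵇx (<⇒<ᵇ≡true b<a)) ∷ Agree-below⁻ x ys a bs bs<a agree

Agree-below⁺ : ∀ x ys a bs → length ys ≡ length bs → All (_< a) bs → All (_< x) ys → Agree x ys a bs
Agree-below⁺ x []       a []       _   _            _            = tt
Agree-below⁺ x (y ∷ ys) a (b ∷ bs) len (b<a ∷ bs<a) (y<x ∷ ys<x) =
  (trans (<⇒>ᵇ≡false y<x) (sym (<⇒>ᵇ≡false b<a)) , trans (<⇒<ᵇ≡true y<x) (sym (<⇒<ᵇ≡true b<a))) ,
  Agree-below⁺ x ys a bs (ℕ.suc-injective len) bs<a ys<x

downFrom-bounded : ∀ k → All (_< suc k) (applyDownFrom suc k)
downFrom-bounded k = All.applyDownFrom⁺₁ suc k s≤s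

OrderIso-downFrom⁻ : ∀ k s → OrderIso s (applyDownFrom suc k) → length s ≡ k × AllPairs _>_ s
OrderIso-downFrom⁻ zero    []       _             = refl , []
OrderIso-downFrom⁻ (suc k) (x ∷ xs) (agree , iso) =
  let len , decreasing = OrderIso-downFrom⁻ k xs iso
  in cong suc len , Agree-below⁻ x xs (suc k) _ (downFrom-bounded k) agree ∷ decreasing

OrderIso-downFrom⁺ : ∀ k s → length s ≡ k → AllPairs _>_ s → OrderIso s (applyDownFrom suc k)
OrderIso-downFrom⁺ zero    []       _   _                    = tt
OrderIso-downFrom⁺ (suc k) (x ∷ xs) len (xs<x ∷ decreasing) =
  Agree-below⁺ x xs (suc k) _ (trans (ℕ.suc-injective len) (sym (length-applyDownFrom suc k)))
    (downFrom-bounded k) xs<x ,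
  OrderIso-downFrom⁺ k xs (ℕ.suc-injective len) decreasing

containsDecreasing⁻ : ∀ {π} k → Contains π (decr k) → HasDecreasing k π
containsDecreasing⁻ k (s , sub , iso) =
  s , sub , OrderIso-downFrom⁻ k s (subst (OrderIso s) (reverse-applyUpTo suc k) iso)

containsDecreasing⁺ : ∀ {π} k → HasDecreasing k π → Contains π (decr k)
containsDecreasing⁺ k (s , sub , len , decreasing) =
  s , sub , subst (OrderIso s) (sym (reverse-applyUpTo suc k)) (OrderIso-downFrom⁺ k s len decreasing)

∈-subseqs⁻ : ∀ π {s} → s ∈ subseqs π → s ⊆ π
∈-subseqs⁻ []      (here refl) = []
∈-subseqs⁻ (x ∷ π) s∈ with ∈-++⁻ (map (x ∷_) (subseqs π)) s∈
... | inj₂ s∈′ = x ∷ʳ ∈-subseqs⁻ π s∈′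
... | inj₁ x∷s′∈ with s′ , s′∈ , refl ← ∈-map⁻ (x ∷_) x∷s′∈ = refl ∷ ∈-subseqs⁻ π s′∈

∈-subseqs⁺ : ∀ {π s} → s ⊆ π → s ∈ subseqs π
∈-subseqs⁺               []         = here refl
∈-subseqs⁺ {x ∷ π}       (x ∷ʳ sub) = ∈-++⁺ʳ (map (x ∷_) (subseqs π)) (∈-subseqs⁺ sub)
∈-subseqs⁺               (refl ∷ sub) = ∈-++⁺ˡ (∈-map⁺ _ (∈-subseqs⁺ sub))

contains⁻ : ∀ π σ → T (contains π σ) → Contains π σ
contains⁻ π σ t with s , s∈ , iso ← find (any⁻ (λ s → orderIso s σ) (subseqs π) t) =
  s , ∈-subseqs⁻ π s∈ , orderIso⁻ s σ iso

contains⁺ : ∀ π σ → Contains π σ → T (contains π σ)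
contains⁺ π σ (s , sub , iso) = any⁺ _ (lose (∈-subseqs⁺ sub) (orderIso⁺ s σ iso))

T-not⁻ : ∀ b → T (not b) → ¬ T b
T-not⁻ false _ ()

T-not⁺ : ∀ b → ¬ T b → T (not b)
T-not⁺ false _  = tt
T-not⁺ true  ¬t = ¬t tt

avoids⁻ : ∀ π σ → T (avoids π σ) → ¬ Contains π σ
avoids⁻ π σ t c = T-not⁻ _ t (contains⁺ π σ c)

avoids⁺ : ∀ π σ → ¬ Contains π σ → T (avoids π σ)
avoids⁺ π σ ¬c = T-not⁺ _ (λ t → ¬c (contains⁻ π σ t))

record Admissible (d : ℕ) (π : List ℕ) : Set where
  constructor admissible
  field
    no132        : ¬ Has132 π
    no2341or3241 : ¬ Has2341or3241 π
    noDecreasing : ¬ HasDecreasing d π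

admissibleᵇ : ℕ → List ℕ → Bool
admissibleᵇ d π = avoids π (1 ∷ 3 ∷ 2 ∷ []) ∧ avoids π (2 ∷ 3 ∷ 4 ∷ 1 ∷ [])
                ∧ avoids π (3 ∷ 2 ∷ 4 ∷ 1 ∷ []) ∧ avoids π (decr d)

admissible⁻ : ∀ d π → T (admissibleᵇ d π) → Admissible d π
admissible⁻ d π t =
  let t₁ , t₂₃₄ = Equivalence.to T-∧ t
      t₂ , t₃₄  = Equivalence.to T-∧ t₂₃₄
      t₃ , t₄   = Equivalence.to T-∧ t₃₄
  in admissible (λ h → avoids⁻ π _ t₁ (contains132⁺ h))
                (λ h → [ avoids⁻ π _ t₂ , avoids⁻ π _ t₃ ]′ (contains2341or3241⁺ h))
                (λ h → avoids⁻ π _ t₄ (containsDecreasing⁺ d h))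

admissible⁺ : ∀ d π → Admissible d π → T (admissibleᵇ d π)
admissible⁺ d π (admissible no132 no2341or3241 noDecreasing) =
  Equivalence.from T-∧ (avoids⁺ π _ (λ c → no132 (contains132⁻ c)) ,
  Equivalence.from T-∧ (avoids⁺ π _ (λ c → no2341or3241 (contains2341⁻ c)) ,
  Equivalence.from T-∧ (avoids⁺ π _ (λ c → no2341or3241 (contains3241⁻ c)) ,
                        avoids⁺ π _ (λ c → noDecreasing (containsDecreasing⁻ d c)))))

-- Permutations

InRange : ℕ → ℕ → Set
InRange n x = 0 < x × x ≤ n

record IsPerm (n : ℕ) (π : List ℕ) : Set where
  constructor isPerm
  field
    length≡ : length π ≡ n
    inRange : All (InRange n) π
    unique  : Unique π

∈-words⁻ : ∀ n k {π} → π ∈ words n k → length π ≡ n × All (InRange k) π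
∈-words⁻ zero    k (here refl) = refl , []
∈-words⁻ (suc n) k π∈
  with w , w∈ , π∈′ ← find (∈-concatMap⁻ (λ w → map (λ a → suc a ∷ w) (upTo k)) {xs = words n k} π∈)
  with a , a∈ , refl ← ∈-map⁻ (λ a → suc a ∷ w) π∈′
  with len , inRange ← ∈-words⁻ n k w∈
  = cong suc len , (s≤s z≤n , ∈-upTo⁻ a∈) ∷ inRange

∈-words⁺ : ∀ n k {π} → length π ≡ n → All (InRange k) π → π ∈ words n k
∈-words⁺ zero    k {[]}        refl []                       = here refl
∈-words⁺ (suc n) k {suc a ∷ π} refl ((_ , a<k) ∷ inRange) =
  ∈-concatMap⁺ (λ w → map (λ a → suc a ∷ w) (upTo k)) {xs = words n k}
    (lose (∈-words⁺ n k refl inRange) (∈-map⁺ (λ a → suc a ∷ π) (∈-upTo⁺ a<k)))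

words-unique : ∀ n k → Unique (words n k)
words-unique zero    k = [] ∷ []
words-unique (suc n) k =
  Unique.concat⁺ (All.map⁺ (All.tabulate λ {w} _ → Unique.map⁺ (suc-∷-injective {w}) (Unique.upTo⁺ k)))
                 (AllPairs.map⁺ (AllPairs.map disjoint (words-unique n k)))
  where
  extensions : List ℕ → List (List ℕ)
  extensions w = map (λ a → suc a ∷ w) (upTo k)
  suc-∷-injective : ∀ {w a b} → suc a ∷ w ≡ suc b ∷ w → a ≡ b
  suc-∷-injective refl = refl
  disjoint : ∀ {w w′} → w ≢ w′ → ∀ {v} → ¬ (v ∈ extensions w × v ∈ extensions w′)
  disjoint {w} {w′} w≢w′ (v∈ , v∈′)
    with _ , _ , refl ← ∈-map⁻ (λ a → suc a ∷ w) v∈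
    with _ , _ , refl ← ∈-map⁻ (λ a → suc a ∷ w′) v∈′ = w≢w′ refl

distinct⁻ : ∀ π → T (distinct π) → Unique π
distinct⁻ []      _ = []
distinct⁻ (x ∷ π) t =
  let t₁ , t₂ = Equivalence.to T-∧ t
  in All.map (λ {y} t → T-not⁻ _ t ∘ ℕ.≡⇒≡ᵇ x y) (All.all⁺ _ π t₁) ∷ distinct⁻ π t₂

distinct⁺ : ∀ π → Unique π → T (distinct π)
distinct⁺ []      _            = tt
distinct⁺ (x ∷ π) (x∉π ∷ uπ) =
  Equivalence.from T-∧ (All.all⁻ _ (All.map (λ {y} x≢y → T-not⁺ _ (x≢y ∘ ℕ.≡ᵇ⇒≡ x y)) x∉π) ,
                        distinct⁺ π uπ)

∈-Sn⁻ : ∀ n {π} → π ∈ Sn n → IsPerm n π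
∈-Sn⁻ n {π} π∈ with π∈′ , t ← ∈-filter⁻ (λ w → T? (distinct w)) {xs = words n n} π∈ =
  let len , inRange = ∈-words⁻ n n π∈′ in isPerm len inRange (distinct⁻ π t)

∈-Sn⁺ : ∀ n {π} → IsPerm n π → π ∈ Sn n
∈-Sn⁺ n {π} (isPerm len inRange u) =
  ∈-filter⁺ (λ w → T? (distinct w)) (∈-words⁺ n n len inRange) (distinct⁺ π u)

Sn-unique : ∀ n → Unique (Sn n)
Sn-unique n = Unique.filter⁺ (λ w → T? (distinct w)) (words-unique n n)

Unique-resp-⊆ : ∀ {s t : List ℕ} → s ⊆ t → Unique t → Unique s
Unique-resp-⊆ []           []          = []
Unique-resp-⊆ (_ ∷ʳ sub)   (_ ∷ u)     = Unique-resp-⊆ sub u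
Unique-resp-⊆ (refl ∷ sub) (x∉ ∷ u)    = All-resp-⊆ sub x∉ ∷ Unique-resp-⊆ sub u

delete-⊆ : ∀ (ys : List ℕ) {x zs} → ys ++ zs ⊆ ys ++ x ∷ zs
delete-⊆ ys {x} = ++⁺ ⊆-refl (x ∷ʳ ⊆-refl)

All-insert : ∀ {P : ℕ → Set} (ys : List ℕ) {x zs} → P x → All P (ys ++ zs) → All P (ys ++ x ∷ zs)
All-insert ys px pyszs = All.++⁺ (All.++⁻ˡ ys pyszs) (px ∷ All.++⁻ʳ ys pyszs)

Unique-insert : ∀ (ys : List ℕ) {x zs} → x ∉ ys ++ zs → Unique (ys ++ zs) → Unique (ys ++ x ∷ zs)
Unique-insert []       x∉ u          = All.¬Any⇒All¬ _ x∉ ∷ u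
Unique-insert (y ∷ ys) x∉ (y∉ ∷ u) =
  All-insert ys (λ y≡x → x∉ (here (sym y≡x))) y∉ ∷ Unique-insert ys (x∉ ∘ there) u

Unique-∉ : ∀ (ys : List ℕ) {x zs} → Unique (ys ++ x ∷ zs) → x ∉ ys ++ zs
Unique-∉ []       (x∉ ∷ _) x∈          = All.All¬⇒¬Any x∉ x∈
Unique-∉ (y ∷ ys) (y∉ ∷ _) (here refl) = All.lookup y∉ (∈-insert ys) refl
Unique-∉ (y ∷ ys) (_ ∷ u)  (there x∈)  = Unique-∉ ys u x∈

InRange-pred : ∀ {m y} → InRange (suc m) y → suc m ≢ y → InRange m y
InRange-pred (0<y , y≤1+m) 1+m≢y = 0<y , ℕ.≤-pred (ℕ.≤∧≢⇒< y≤1+m (1+m≢y ∘ sym))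

InRange-pred-all : ∀ {m xs} → suc m ∉ xs → All (InRange (suc m)) xs → All (InRange m) xs
InRange-pred-all {xs = xs} m∉ inRange =
  All.zipWith (λ (r , ne) → InRange-pred r ne) (inRange , All.¬Any⇒All¬ xs m∉)

deleteMax : ∀ {m} (ys : List ℕ) {zs} →
  All (InRange (suc m)) (ys ++ suc m ∷ zs) → Unique (ys ++ suc m ∷ zs) →
  All (InRange m) (ys ++ zs) × Unique (ys ++ zs)
deleteMax ys inRange u =
  InRange-pred-all (Unique-∉ ys u) (All-resp-⊆ (delete-⊆ ys) inRange) , Unique-resp-⊆ (delete-⊆ ys) u

pigeonhole : ∀ m {xs} → Unique xs → All (InRange m) xs → length xs ≤ m
pigeonhole zero    {[]}    _ _                    = z≤n
pigeonhole zero    {_ ∷ _} _ ((0<x , x≤0) ∷ _)    = ⊥-elim (ℕ.<⇒≱ 0<x x≤0)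
pigeonhole (suc m) {xs}    u inRange with suc m ∈? xs
... | no  m∉ = ℕ.m≤n⇒m≤1+n (pigeonhole m u (InRange-pred-all m∉ inRange))
... | yes m∈ with ys , zs , refl ← ∈-∃++ m∈ =
  let inRange′ , u′ = deleteMax ys inRange u
  in subst (_≤ suc m) (sym (length-++-sucʳ ys (suc m) zs)) (s≤s (pigeonhole m u′ inRange′))

max∈ : ∀ {m π} → IsPerm (suc m) π → suc m ∈ π
max∈ {m} {π} (isPerm len inRange u) with suc m ∈? π
... | yes m∈ = m∈
... | no  m∉ = ⊥-elim (ℕ.1+n≰n (subst (_≤ m) len (pigeonhole m u (InRange-pred-all m∉ inRange))))

removeMax : ∀ {m} (ys : List ℕ) {zs} → IsPerm (suc m) (ys ++ suc m ∷ zs) → IsPerm m (ys ++ zs)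
removeMax ys {zs} (isPerm len inRange u) =
  let inRange′ , u′ = deleteMax ys inRange u
  in isPerm (ℕ.suc-injective (trans (sym (length-++-sucʳ ys _ zs)) len)) inRange′ u′

insertMax : ∀ {m} (ys : List ℕ) {zs} → IsPerm m (ys ++ zs) → IsPerm (suc m) (ys ++ suc m ∷ zs)
insertMax {m} ys {zs} (isPerm len inRange u) =
  isPerm (trans (length-++-sucʳ ys _ zs) (cong suc len))
         (All-insert ys (s≤s z≤n , ℕ.≤-refl) (All.map (λ (0<x , x≤m) → 0<x , ℕ.m≤n⇒m≤1+n x≤m) inRange))
         (Unique-insert ys (λ m∈ → ℕ.1+n≰n (proj₂ (All.lookup inRange m∈))) u)

unique-same-length : ∀ {xs ys : List (List ℕ)} → Unique xs → Unique ys →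
  (∀ {z} → z ∈ xs → z ∈ ys) → (∀ {z} → z ∈ ys → z ∈ xs) → length xs ≡ length ys
unique-same-length uxs uys xs⊆ys ys⊆xs = ↭-length (∼bag⇒↭ (unique∧set⇒bag uxs uys (mk⇔ xs⊆ys ys⊆xs)))

-- Admissible permutations and their recurrence

𝒫 : ℕ → ℕ → List (List ℕ)
𝒫 d n = filter (λ π → T? (admissibleᵇ d π)) (Sn n)

∈-𝒫⁻ : ∀ d n {π} → π ∈ 𝒫 d n → IsPerm n π × Admissible d π
∈-𝒫⁻ d n {π} π∈ with π∈′ , t ← ∈-filter⁻ (λ π → T? (admissibleᵇ d π)) {xs = Sn n} π∈ =
  ∈-Sn⁻ n π∈′ , admissible⁻ d π t

∈-𝒫⁺ : ∀ d n {π} → IsPerm n π → Admissible d π → π ∈ 𝒫 d n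
∈-𝒫⁺ d n {π} perm adm = ∈-filter⁺ (λ π → T? (admissibleᵇ d π)) (∈-Sn⁺ n perm) (admissible⁺ d π adm)

𝒫-unique : ∀ d n → Unique (𝒫 d n)
𝒫-unique d n = Unique.filter⁺ (λ π → T? (admissibleᵇ d π)) (Sn-unique n)

Has132-⊆ : ∀ {s π} → s ⊆ π → Has132 s → Has132 π
Has132-⊆ s⊆π (a , b , c , sub , rest) = a , b , c , ⊆-trans sub s⊆π , rest

Has2341or3241-⊆ : ∀ {s π} → s ⊆ π → Has2341or3241 s → Has2341or3241 π
Has2341or3241-⊆ s⊆π (x , y , z , w , sub , rest) = x , y , z , w , ⊆-trans sub s⊆π , rest

HasDecreasing-⊆ : ∀ {d s π} → s ⊆ π → HasDecreasing d s → HasDecreasing d π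
HasDecreasing-⊆ s⊆π (t , sub , rest) = t , ⊆-trans sub s⊆π , rest

Admissible-⊆ : ∀ {d s π} → s ⊆ π → Admissible d π → Admissible d s
Admissible-⊆ s⊆π (admissible no132 no2341or3241 noDecreasing) =
  admissible (no132 ∘ Has132-⊆ s⊆π) (no2341or3241 ∘ Has2341or3241-⊆ s⊆π)
             (noDecreasing ∘ HasDecreasing-⊆ s⊆π)

HasDecreasing-∷ : ∀ {d x β} → All (_< x) β → HasDecreasing d β → HasDecreasing (suc d) (x ∷ β)
HasDecreasing-∷ {x = x} β<x (s , sub , len , decreasing) =
  x ∷ s , refl ∷ sub , cong suc len , All-resp-⊆ sub β<x ∷ decreasing

HasDecreasing-drop : ∀ {d β} → HasDecreasing (suc d) β → HasDecreasing d β
HasDecreasing-drop (x ∷ s , sub , len , _ ∷ decreasing) = s , ∷ˡ⁻ sub , ℕ.suc-injective len , decreasing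

no132-∷ : ∀ {x β} → All (_< x) β → ¬ Has132 β → ¬ Has132 (x ∷ β)
no132-∷ β<x no132 (a , b , c , _ ∷ʳ sub , rest)      = no132 (a , b , c , sub , rest)
no132-∷ β<x no132 (a , b , c , refl ∷ sub , a<c , _) with _ ∷ c<a ∷ [] ← All-resp-⊆ sub β<x =
  ℕ.<-asym a<c c<a

no2341or3241-∷ : ∀ {x β} → All (_< x) β → ¬ Has2341or3241 β → ¬ Has2341or3241 (x ∷ β)
no2341or3241-∷ β<x no4 (x , y , z , w , _ ∷ʳ sub , rest) = no4 (x , y , z , w , sub , rest)
no2341or3241-∷ β<x no4 (x , y , z , w , refl ∷ sub , _ , _ , x<z , _)
  with _ ∷ z<x ∷ _ ← All-resp-⊆ sub β<x = ℕ.<-asym x<z z<x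

noDecreasing-∷ : ∀ {d x β} → ¬ HasDecreasing d β → ¬ HasDecreasing (suc d) (x ∷ β)
noDecreasing-∷ noDecreasing (s , _ ∷ʳ sub , len , decreasing) =
  noDecreasing (HasDecreasing-drop (s , sub , len , decreasing))
noDecreasing-∷ noDecreasing (_ ∷ s , refl ∷ sub , len , _ ∷ decreasing) =
  noDecreasing (s , sub , ℕ.suc-injective len , decreasing)

prependMax-admissible : ∀ {d x β} → All (_< x) β → Admissible d β → Admissible (suc d) (x ∷ β)
prependMax-admissible β<x (admissible no132 no2341or3241 noDecreasing) =
  admissible (no132-∷ β<x no132) (no2341or3241-∷ β<x no2341or3241) (noDecreasing-∷ noDecreasing)

prependTwo-admissible : ∀ {d m β} → All (_< m) β → Admissible d β → Admissible (suc d) (m ∷ suc m ∷ β)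
prependTwo-admissible {d} {m} {β} β<m adm = admissible no132 no2341or3241 noDecreasing
  where
  β<1+m : All (_< suc m) β
  β<1+m = All.map ℕ.m<n⇒m<1+n β<m
  open Admissible (prependMax-admissible β<1+m adm) renaming
    (no132 to no132′; no2341or3241 to no2341or3241′; noDecreasing to noDecreasing′)
  no132 : ¬ Has132 (m ∷ suc m ∷ β)
  no132 (a , b , c , _ ∷ʳ sub , rest)      = no132′ (a , b , c , sub , rest)
  no132 (a , b , c , refl ∷ sub , a<c , _) with c<m ∷ [] ← All-resp-⊆ (∷⁻ sub) β<m = ℕ.<-asym a<c c<m
  no2341or3241 : ¬ Has2341or3241 (m ∷ suc m ∷ β)
  no2341or3241 (x , y , z , w , _ ∷ʳ sub , rest) = no2341or3241′ (x , y , z , w , sub , rest)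
  no2341or3241 (x , y , z , w , refl ∷ sub , _ , _ , x<z , _)
    with z<m ∷ _ ← All-resp-⊆ (∷⁻ sub) β<m = ℕ.<-asym x<z z<m
  noDecreasing : ¬ HasDecreasing (suc d) (m ∷ suc m ∷ β)
  noDecreasing (s , _ ∷ʳ sub , rest) = noDecreasing′ (s , sub , rest)
  noDecreasing (_ ∷ s , refl ∷ _ ∷ʳ sub , len , _ ∷ decreasing) =
    Admissible.noDecreasing adm (s , sub , ℕ.suc-injective len , decreasing)
  noDecreasing (_ ∷ _ ∷ _ , refl ∷ refl ∷ _ , _ , (1+m<m ∷ _) ∷ _) = ℕ.<-asym 1+m<m (ℕ.n<1+n m)

⊆-∷ʳ⁻ : ∀ {s} (α : List ℕ) {x} → s ⊆ α ++ [ x ] → s ⊆ α ⊎ ∃[ s′ ] s ≡ s′ ++ [ x ] × s′ ⊆ α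
⊆-∷ʳ⁻ []      (_ ∷ʳ [])    = inj₁ []
⊆-∷ʳ⁻ []      (refl ∷ [])  = inj₂ ([] , refl , [])
⊆-∷ʳ⁻ (a ∷ α) (a ∷ʳ sub)   with ⊆-∷ʳ⁻ α sub
... | inj₁ sub′              = inj₁ (a ∷ʳ sub′)
... | inj₂ (s′ , eq , sub′)  = inj₂ (s′ , eq , a ∷ʳ sub′)
⊆-∷ʳ⁻ (a ∷ α) (refl ∷ sub) with ⊆-∷ʳ⁻ α sub
... | inj₁ sub′              = inj₁ (refl ∷ sub′)
... | inj₂ (s′ , eq , sub′)  = inj₂ (a ∷ s′ , cong (a ∷_) eq , refl ∷ sub′)

appendMax-admissible : ∀ {d x y α} → All (_< x) (y ∷ α) → Admissible (suc d) (y ∷ α) →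
  Admissible (suc d) (y ∷ α ++ [ x ])
appendMax-admissible {d} {x} {y} {α} α<x (admissible no132 no2341or3241 noDecreasing) =
  admissible no132′ no2341or3241′ noDecreasing′
  where
  no132′ : ¬ Has132 (y ∷ α ++ [ x ])
  no132′ (a , b , c , sub , a<c , c<b) with ⊆-∷ʳ⁻ (y ∷ α) sub
  ... | inj₁ sub′ = no132 (a , b , c , sub′ , a<c , c<b)
  ... | inj₂ (s′ , eq , sub′) with refl , refl ← ∷ʳ-injective (a ∷ b ∷ []) s′ eq
                               with _ ∷ b<x ∷ [] ← All-resp-⊆ sub′ α<x = ℕ.<-asym c<b b<x
  no2341or3241′ : ¬ Has2341or3241 (y ∷ α ++ [ x ])
  no2341or3241′ (u , v , z , w , sub , rest) with ⊆-∷ʳ⁻ (y ∷ α) sub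
  ... | inj₁ sub′ = no2341or3241 (u , v , z , w , sub′ , rest)
  ... | inj₂ (s′ , eq , sub′) with refl , refl ← ∷ʳ-injective (u ∷ v ∷ z ∷ []) s′ eq
                               with u<x ∷ _ ← All-resp-⊆ sub′ α<x = ℕ.<-asym u<x (proj₁ rest)
  noDecreasing′ : ¬ HasDecreasing (suc d) (y ∷ α ++ [ x ])
  noDecreasing′ (s , sub , len , decreasing) with ⊆-∷ʳ⁻ (y ∷ α) sub
  ... | inj₁ sub′ = noDecreasing (s , sub′ , len , decreasing)
  ... | inj₂ ([] , refl , _) = noDecreasing (y ∷ [] , refl ∷ minimum α , len , [] ∷ [])
  ... | inj₂ (t ∷ s′ , refl , sub′) with t<x ∷ _ ← All-resp-⊆ sub′ α<x
    = ℕ.<-asym t<x (All.lookup (AllPairs.head decreasing) (∈-insert s′))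

IsPerm-bounded : ∀ {m π} → IsPerm m π → All (_< suc m) π
IsPerm-bounded (isPerm _ inRange _) = All.map (λ (_ , x≤m) → s≤s x≤m) inRange

IsPerm-nonempty : ∀ {m π} → IsPerm (suc m) π → π ≢ []
IsPerm-nonempty {π = []}    (isPerm () _ _)
IsPerm-nonempty {π = _ ∷ _} _ ()

Unique-disjoint : ∀ (α : List ℕ) {β x} → Unique (α ++ β) → x ∈ α → x ∉ β
Unique-disjoint (a ∷ α) (a∉ ∷ _) (here refl) x∈β = All.lookup a∉ (∈-++⁺ʳ α x∈β) refl
Unique-disjoint (a ∷ α) (_ ∷ u)  (there x∈α) x∈β = Unique-disjoint α u x∈α x∈β

snoc≢cons : ∀ {x α β} → All (_< x) α → β ≢ [] → α ++ [ x ] ≢ x ∷ β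
snoc≢cons {α = []}    _           β≢[] eq = β≢[] (sym (∷-injectiveʳ eq))
snoc≢cons {α = _ ∷ _} (a<x ∷ _)   _    eq = ℕ.<-irrefl (∷-injectiveˡ eq) a<x

module Recurrence (d j : ℕ) where

  m N : ℕ
  m = suc (suc j)
  N = suc m

  𝒜 ℬ 𝒞 ℛ : List (List ℕ)
  𝒜 = map (_++ [ N ]) (𝒫 (suc d) m)
  ℬ = map (N ∷_) (𝒫 d m)
  𝒞 = map (λ β → m ∷ N ∷ β) (𝒫 d (suc j))
  ℛ = 𝒜 ++ ℬ ++ 𝒞

  ℛ⊆𝒫 : ∀ {π} → π ∈ ℛ → π ∈ 𝒫 (suc d) N
  ℛ⊆𝒫 π∈ with ∈-++⁻ 𝒜 π∈
  ... | inj₁ π∈𝒜 with α , α∈ , refl ← ∈-map⁻ (_++ [ N ]) π∈𝒜 = appended α (∈-𝒫⁻ (suc d) m α∈)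
    where
    appended : ∀ α → IsPerm m α × Admissible (suc d) α → α ++ [ N ] ∈ 𝒫 (suc d) N
    appended []      (perm , _)   = ⊥-elim (IsPerm-nonempty perm refl)
    appended (y ∷ α) (perm , adm) = ∈-𝒫⁺ (suc d) N
      (insertMax (y ∷ α) (subst (IsPerm m) (sym (++-identityʳ (y ∷ α))) perm))
      (appendMax-admissible (IsPerm-bounded perm) adm)
  ... | inj₂ π∈ℬ𝒞 with ∈-++⁻ ℬ π∈ℬ𝒞
  ... | inj₁ π∈ℬ with β , β∈ , refl ← ∈-map⁻ (N ∷_) π∈ℬ =
    let perm , adm = ∈-𝒫⁻ d m β∈
    in ∈-𝒫⁺ (suc d) N (insertMax [] perm) (prependMax-admissible (IsPerm-bounded perm) adm)
  ... | inj₂ π∈𝒞 with β , β∈ , refl ← ∈-map⁻ (λ β → m ∷ N ∷ β) π∈𝒞 =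
    let perm , adm = ∈-𝒫⁻ d (suc j) β∈
    in ∈-𝒫⁺ (suc d) N (insertMax [ m ] (insertMax [] perm))
                      (prependTwo-admissible (IsPerm-bounded perm) adm)

  separated : ∀ α {β x b} → IsPerm m (α ++ β) → Admissible (suc d) (α ++ N ∷ β) →
    x ∈ α → b ∈ β → b < x
  separated α {x = x} {b} perm adm x∈α b∈β with ℕ.<-cmp x b
  ... | tri< x<b _ _  = ⊥-elim (Admissible.no132 adm (x , N , b , ++⁺ (from∈ x∈α) (refl ∷ from∈ b∈β) ,
                                                      x<b , All.lookup (IsPerm-bounded perm) (∈-++⁺ʳ α b∈β)))
  ... | tri≈ _ refl _ = ⊥-elim (Unique-disjoint α (IsPerm.unique perm) x∈α b∈β)
  ... | tri> _ _ b<x  = b<x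

  split : ∀ α β → IsPerm m (α ++ β) → Admissible (suc d) (α ++ N ∷ β) → α ++ N ∷ β ∈ ℛ
  split α [] perm adm =
    ∈-++⁺ˡ (∈-map⁺ (_++ [ N ]) (∈-𝒫⁺ (suc d) m (subst (IsPerm m) (++-identityʳ α) perm)
                                                (Admissible-⊆ (++⁺ʳ [ N ] ⊆-refl) adm)))
  split [] β perm (admissible no132 no2341or3241 noDecreasing) =
    ∈-++⁺ʳ 𝒜 (∈-++⁺ˡ (∈-map⁺ (N ∷_) (∈-𝒫⁺ d m perm adm′)))
    where
    adm′ : Admissible d β
    adm′ = admissible (no132 ∘ Has132-⊆ (N ∷ʳ ⊆-refl))
                      (no2341or3241 ∘ Has2341or3241-⊆ (N ∷ʳ ⊆-refl))
                      (noDecreasing ∘ HasDecreasing-∷ (IsPerm-bounded perm))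
  split (x ∷ []) β perm adm with max∈ perm
  ... | there m∈β = ⊥-elim (ℕ.≤⇒≯ (proj₂ (All.head (IsPerm.inRange perm)))
                                  (separated [ x ] perm adm (here refl) m∈β))
  ... | here refl =
    ∈-++⁺ʳ 𝒜 (∈-++⁺ʳ ℬ (∈-map⁺ (λ β → m ∷ N ∷ β) (∈-𝒫⁺ d (suc j) (removeMax [] perm) adm′)))
    where
    open Admissible adm
    β<m : All (_< m) β
    β<m = All.tabulate (separated [ m ] perm adm (here refl))
    adm′ : Admissible d β
    adm′ = admissible (no132 ∘ Has132-⊆ (m ∷ʳ N ∷ʳ ⊆-refl))
                      (no2341or3241 ∘ Has2341or3241-⊆ (m ∷ʳ N ∷ʳ ⊆-refl))
                      (noDecreasing ∘ HasDecreasing-⊆ (refl ∷ N ∷ʳ ⊆-refl) ∘ HasDecreasing-∷ β<m)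
  split (x ∷ y ∷ α) (b ∷ β) perm adm = ⊥-elim (Admissible.no2341or3241 adm
    (x , y , N , b , refl ∷ refl ∷ ++⁺ˡ α (refl ∷ refl ∷ minimum β) ,
     b<a (here refl) , b<a (there (here refl)) , a<N (here refl) , a<N (there (here refl)) ,
     All.head (AllPairs.head (IsPerm.unique perm))))
    where
    b<a : ∀ {a} → a ∈ x ∷ y ∷ α → b < a
    b<a a∈ = separated (x ∷ y ∷ α) perm adm a∈ (here refl)
    a<N : ∀ {a} → a ∈ x ∷ y ∷ α → a < N
    a<N a∈ = All.lookup (IsPerm-bounded perm) (∈-++⁺ˡ a∈)

  𝒫⊆ℛ : ∀ {π} → π ∈ 𝒫 (suc d) N → π ∈ ℛ
  𝒫⊆ℛ π∈ with perm , adm ← ∈-𝒫⁻ (suc d) N π∈ with α , β , refl ← ∈-∃++ (max∈ perm) =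
    split α β (removeMax α perm) adm

  ℛ-unique : Unique ℛ
  ℛ-unique = Unique.++⁺ (Unique.map⁺ (λ eq → proj₁ (∷ʳ-injective _ _ eq)) (𝒫-unique (suc d) m))
               (Unique.++⁺ (Unique.map⁺ ∷-injectiveʳ (𝒫-unique d m))
                           (Unique.map⁺ (∷-injectiveʳ ∘ ∷-injectiveʳ) (𝒫-unique d (suc j))) ℬ∩𝒞=∅)
               𝒜∩ℬ𝒞=∅
    where
    ℬ∩𝒞=∅ : ∀ {π} → ¬ (π ∈ ℬ × π ∈ 𝒞)
    ℬ∩𝒞=∅ (π∈ℬ , π∈𝒞)
      with _ , _ , refl ← ∈-map⁻ (N ∷_) π∈ℬ
      with _ , _ , eq   ← ∈-map⁻ (λ β → m ∷ N ∷ β) π∈𝒞 = ℕ.1+n≢n (∷-injectiveˡ eq)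
    𝒜∩ℬ𝒞=∅ : ∀ {π} → ¬ (π ∈ 𝒜 × π ∈ ℬ ++ 𝒞)
    𝒜∩ℬ𝒞=∅ (π∈𝒜 , π∈ℬ𝒞) with α , α∈ , refl ← ∈-map⁻ (_++ [ N ]) π∈𝒜 with ∈-++⁻ ℬ π∈ℬ𝒞
    ... | inj₁ π∈ℬ with _ , β∈ , eq ← ∈-map⁻ (N ∷_) π∈ℬ =
      snoc≢cons (IsPerm-bounded (proj₁ (∈-𝒫⁻ (suc d) m α∈))) (IsPerm-nonempty (proj₁ (∈-𝒫⁻ d m β∈))) eq
    ... | inj₂ π∈𝒞 with _ , β∈ , eq ← ∈-map⁻ (λ β → m ∷ N ∷ β) π∈𝒞
                   with α | IsPerm-bounded (proj₁ (∈-𝒫⁻ (suc d) m α∈))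
    ...   | []    | _        = ℕ.1+n≢n (∷-injectiveˡ eq)
    ...   | _ ∷ _ | _ ∷ α<N  =
      snoc≢cons α<N (IsPerm-nonempty (proj₁ (∈-𝒫⁻ d (suc j) β∈))) (∷-injectiveʳ eq)

  count : length (𝒫 (suc d) N) ≡ length (𝒫 (suc d) m) ℕ.+ (length (𝒫 d m) ℕ.+ length (𝒫 d (suc j)))
  count = trans (unique-same-length (𝒫-unique (suc d) N) ℛ-unique 𝒫⊆ℛ ℛ⊆𝒫) (begin
    length (𝒜 ++ ℬ ++ 𝒞)                        ≡⟨ length-++ 𝒜 ⟩
    length 𝒜 ℕ.+ length (ℬ ++ 𝒞)                ≡⟨ cong (length 𝒜 ℕ.+_) (length-++ ℬ) ⟩
    length 𝒜 ℕ.+ (length ℬ ℕ.+ length 𝒞)        ≡⟨ cong₂ ℕ._+_ (length-map _ (𝒫 (suc d) m))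
                                                      (cong₂ ℕ._+_ (length-map _ (𝒫 d m)) (length-map _ (𝒫 d (suc j)))) ⟩
    length (𝒫 (suc d) m) ℕ.+ (length (𝒫 d m) ℕ.+ length (𝒫 d (suc j))) ∎)
    where open ≡-Reasoning

-- countP (decr d) n unfolds to length (𝒫 d n).
countP-recurrence : ∀ d j → countP (decr (suc d)) (3 ℕ.+ j) ≡
  countP (decr (suc d)) (2 ℕ.+ j) ℕ.+ (countP (decr d) (2 ℕ.+ j) ℕ.+ countP (decr d) (1 ℕ.+ j))
countP-recurrence = Recurrence.count

decr-length : ∀ d → length (decr d) ≡ d
decr-length d = trans (cong length (reverse-applyUpTo suc d)) (length-applyDownFrom suc d)

avoids-longer : ∀ π σ → length π < length σ → T (avoids π σ)
avoids-longer π σ π<σ = avoids⁺ π σ λ (s , sub , iso) →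
  ℕ.<⇒≱ π<σ (subst (_≤ length π) (OrderIso-length s σ iso) (length-mono-≤ sub))

countP-short : ∀ d n → n ≤ 2 → n < d → countP (decr d) n ≡ length (Sn n)
countP-short d n n≤2 n<d = cong length (filter-all (λ π → T? (admissibleᵇ d π)) (All.tabulate short))
  where
  short : ∀ {π} → π ∈ Sn n → T (admissibleᵇ d π)
  short {π} π∈ =
    let π<3 = subst (_< 3) (sym (IsPerm.length≡ (∈-Sn⁻ n π∈))) (s≤s n≤2)
        π<4 = ℕ.m<n⇒m<1+n π<3
    in Equivalence.from T-∧ (avoids-longer π _ π<3 , Equivalence.from T-∧ (avoids-longer π _ π<4 ,
       Equivalence.from T-∧ (avoids-longer π _ π<4 ,
       avoids-longer π (decr d) (subst (length π <_) (sym (decr-length d))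
                                       (subst (_< d) (sym (IsPerm.length≡ (∈-Sn⁻ n π∈))) n<d)))))

countP-decr1-suc : ∀ n → countP (decr 1) (suc n) ≡ 0
countP-decr1-suc n = cong length (filter-none (λ π → T? (admissibleᵇ 1 π)) (All.tabulate contains1))
  where
  contains1 : ∀ {π} → π ∈ Sn (suc n) → ¬ T (admissibleᵇ 1 π)
  contains1 {[]}    π∈ _ = IsPerm-nonempty (∈-Sn⁻ (suc n) π∈) refl
  contains1 {x ∷ π} _  t =
    Admissible.noDecreasing (admissible⁻ 1 (x ∷ π) t) (x ∷ [] , refl ∷ minimum π , refl , [] ∷ [])

-- The generating function

Pdecr-1≈𝟙 : Pdecr 1 ≈ 𝟙
Pdecr-1≈𝟙 = coefficientwise λ where
  zero    → cong +_ (countP-short 1 0 z≤n (s≤s z≤n))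
  (suc n) → cong +_ (countP-decr1-suc n)

Pdecr-equation : ∀ k → U ⊗ Pdecr (suc (suc k)) ≈ Y ⊗ Pdecr (suc k) ⊕ Q
Pdecr-equation k = recurrence⇒series (countP (decr (suc (suc k)))) (countP (decr (suc k)))
  (countP-short (2 ℕ.+ k) 0 z≤n (s≤s z≤n)) (countP-short (2 ℕ.+ k) 1 (s≤s z≤n) (s≤s (s≤s z≤n)))
  (countP-short (suc k) 0 z≤n (s≤s z≤n)) (countP-two k) (countP-recurrence (suc k))
  where
  countP-two : ∀ k → countP (decr (suc (suc k))) 2 ≡ suc (countP (decr (suc k)) 1)
  countP-two zero    = refl
  countP-two (suc k) = trans (countP-short (3 ℕ.+ k) 2 ℕ.≤-refl (s≤s (s≤s (s≤s z≤n))))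
                             (cong suc (sym (countP-short (2 ℕ.+ k) 1 (s≤s z≤n) (s≤s (s≤s z≤n)))))

numer≈U^k⊗Pdecr : ∀ k → numer (suc k) ≈ U ^ˢ k ⊗ Pdecr (suc k)
numer≈U^k⊗Pdecr zero = begin
  numer 1         ≈⟨ numer1≈𝟙 ⟩
  𝟙               ≈⟨ Pdecr-1≈𝟙 ⟨
  Pdecr 1         ≈⟨ ⊗-identityˡ (Pdecr 1) ⟨
  𝟙 ⊗ Pdecr 1     ∎
  where open ≈-Reasoning
numer≈U^k⊗Pdecr (suc k) = begin
  numer (suc (suc k))                  ≈⟨ numer-suc k ⟩
  Y ⊗ numer (suc k) ⊕ Q ⊗ U ^ˢ k       ≈⟨ +-congʳ {Q ⊗ U ^ˢ k} (*-congˡ {Y} (numer≈U^k⊗Pdecr k)) ⟩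
  Y ⊗ (U ^ˢ k ⊗ P₁) ⊕ Q ⊗ U ^ˢ k       ≈⟨ factor Y (U ^ˢ k) P₁ Q ⟩
  U ^ˢ k ⊗ (Y ⊗ P₁ ⊕ Q)                ≈⟨ *-congˡ {U ^ˢ k} (Pdecr-equation k) ⟨
  U ^ˢ k ⊗ (U ⊗ P₂)                    ≈⟨ reassociate (U ^ˢ k) U P₂ ⟩
  (U ⊗ U ^ˢ k) ⊗ P₂                    ∎
  where
  open ≈-Reasoning
  P₁ P₂ : Series
  P₁ = Pdecr (suc k)
  P₂ = Pdecr (suc (suc k))
  factor : ∀ y u p q → y ⊗ (u ⊗ p) ⊕ q ⊗ u ≈ u ⊗ (y ⊗ p ⊕ q)
  factor = solve 4 (λ y u p q → y :* (u :* p) :+ q :* u := u :* (y :* p :+ q)) ≈-refl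
  reassociate : ∀ v u p → v ⊗ (u ⊗ p) ≈ (u ⊗ v) ⊗ p
  reassociate = solve 3 (λ v u p → v :* (u :* p) := (u :* v) :* p) ≈-refl

generatingFunction : ∀ k → numer (suc k) ⊗ geom ^ˢ k ≈ Pdecr (suc k)
generatingFunction k = begin
  numer (suc k) ⊗ geom ^ˢ k                  ≈⟨ *-congʳ {geom ^ˢ k} (numer≈U^k⊗Pdecr k) ⟩
  (U ^ˢ k ⊗ Pdecr (suc k)) ⊗ geom ^ˢ k       ≈⟨ regroup (U ^ˢ k) (Pdecr (suc k)) (geom ^ˢ k) ⟩
  (U ^ˢ k ⊗ geom ^ˢ k) ⊗ Pdecr (suc k)       ≈⟨ *-congʳ {Pdecr (suc k)} (^ˢ-inverse U⊗geom≈𝟙 k) ⟩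
  𝟙 ⊗ Pdecr (suc k)                          ≈⟨ ⊗-identityˡ (Pdecr (suc k)) ⟩
  Pdecr (suc k)                              ∎
  where
  open ≈-Reasoning
  regroup : ∀ u p g → (u ⊗ p) ⊗ g ≈ (u ⊗ g) ⊗ p
  regroup = solve 3 (λ u p g → (u :* p) :* g := (u :* g) :* p) ≈-refl

-- The identity holds for d = 1 as well; the hypothesis 2 ≤ d only excludes d = 0.
mainTheorem9 : (d : ℕ) → 2 ≤ d → (n : ℕ) →
  Pdecr d n ≡ (numer d ⊗ (geom ^ˢ (d ∸ 1))) n
mainTheorem9 (suc k) _ n = sym (coeff (generatingFunction k) n)
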